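{- Let $v\ge1$ and let $a=(a_0,\dots,a_{v-1})$, $b=(b_0,\dots,b_{v-1})$ form a negaperiodic Golay pair. Then the subsets $X=\Phi_v(a)$ and $Y=\Phi_v(b)$ of $\mathbf{Z}_{2v}$ form a relative difference family in $\mathbf{Z}_{2v}$ with parameter $\lambda=v$.
   Context: For a binary sequence $a=(a_0,\dots,a_{v-1})$ (entries in $\{\pm1\}$) define $\Phi_v(a)=\{i: a_i=1\}\cup\{v+i: a_i=-1\}\subseteq\mathbf{Z}_{2v}$. $\mathrm{NAF}_a(k)=a\cdot aN^k$ where $N$ is the $v\times v$ negacyclic shift matrix ($N_{i,i+1}=1$ for $0\le i\le v-2$, $N_{v-1,0}=-1$, other entries $0$). A negaperiodic Golay pair of length $v$ is a pair $(a,b)$ of binary sequences of length $v$ with $\mathrm{NAF}_a(k)+\mathrm{NAF}_b(k)=0$ for $0<k<v$. Subsets $X_1,\dots,X_s$ of $\mathbf{Z}_{2v}$ form a relative difference family with parameter $\lambda$ if for each $m\in\mathbf{Z}_{2v}\setminus\{0,v\}$ the number of triples $(i,j,k)$ with $i,j\in X_k$ and $i-j\equiv m\pmod{2v}$ equals $\lambda$, and there is no such triple for $m=v$. -}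

module Defs where

open import Data.Nat as ℕ using (ℕ; zero; suc; _∸_)
open import Data.Integer as ℤ using (ℤ; 0ℤ; 1ℤ; -1ℤ)
open import Data.Fin using (Fin; toℕ)
open import Data.Bool using (Bool; true; false; _∧_; if_then_else_)
open import Data.List using (List; map; allFin; foldr)
open import Data.Sign using (Sign)
open import Data.Sum using (_⊎_)
open import Relation.Nullary using (does; ¬_)
open import Relation.Binary.PropositionalEquality using (_≡_)
open import Data.Product using (_×_)

Σℤ : (n : ℕ) → (Fin n → ℤ) → ℤ
Σℤ n f = foldr ℤ._+_ 0ℤ (map f (allFin n))

Σℕ : (n : ℕ) → (Fin n → ℕ) → ℕ
Σℕ n f = foldr ℕ._+_ 0 (map f (allFin n))

BinSeq : ℕ → Set
BinSeq v = Fin v → Sign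

val : Sign → ℤ
val Sign.+ = 1ℤ
val Sign.- = -1ℤ

Vecℤ : ℕ → Set
Vecℤ v = Fin v → ℤ

Mat : ℕ → Set
Mat v = Fin v → Fin v → ℤ

_·_ : ∀ {v} → Vecℤ v → Vecℤ v → ℤ
_·_ {v} x y = Σℤ v (λ i → x i ℤ.* y i)

_⊛_ : ∀ {v} → Vecℤ v → Mat v → Vecℤ v
_⊛_ {v} x M j = Σℤ v (λ i → x i ℤ.* M i j)

_⊗_ : ∀ {v} → Mat v → Mat v → Mat v
_⊗_ {v} A B i j = Σℤ v (λ k → A i k ℤ.* B k j)

idMat : ∀ {v} → Mat v
idMat i j = if does (toℕ i ℕ.≟ toℕ j) then 1ℤ else 0ℤ

_^ᴹ_ : ∀ {v} → Mat v → ℕ → Mat v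
M ^ᴹ zero  = idMat
M ^ᴹ suc k = M ⊗ (M ^ᴹ k)

negaShift : (v : ℕ) → Mat v
negaShift v i j =
  if does (toℕ j ℕ.≟ suc (toℕ i)) then 1ℤ
  else if does (toℕ i ℕ.≟ v ∸ 1) ∧ does (toℕ j ℕ.≟ 0) then -1ℤ
  else 0ℤ

NAF : ∀ {v} → BinSeq v → ℕ → ℤ
NAF {v} a k = (λ i → val (a i)) · ((λ i → val (a i)) ⊛ (negaShift v ^ᴹ k))

IsNegaperiodicGolayPair : (v : ℕ) → BinSeq v → BinSeq v → Set
IsNegaperiodicGolayPair v a b =
  ∀ k → 0 ℕ.< k → k ℕ.< v → NAF a k ℤ.+ NAF b k ≡ 0ℤ

-- subsets of Z_{2v} (elements represented by Fin (2v)) as Boolean predicates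
Subset2 : ℕ → Set
Subset2 v = Fin (2 ℕ.* v) → Bool

isPlus : Sign → Bool
isPlus Sign.+ = true
isPlus Sign.- = false

isMinus : Sign → Bool
isMinus Sign.+ = false
isMinus Sign.- = true

-- Φ_v(a) = {i : a_i = 1} ∪ {v+i : a_i = -1}
Φ : (v : ℕ) → BinSeq v → Subset2 v
Φ v a x with toℕ x ℕ.<? v
... | Relation.Nullary.yes p = isPlus (a (Data.Fin.fromℕ< p))
... | Relation.Nullary.no _  = indexHigh
  where
  indexHigh : Bool
  indexHigh with (toℕ x ∸ v) ℕ.<? v
  ... | Relation.Nullary.yes q = isMinus (a (Data.Fin.fromℕ< q))
  ... | Relation.Nullary.no _  = false

-- i - j ≡ m (mod 2v), for i j m ∈ {0,…,2v-1}: equivalently j + m ∈ {i, i + 2v}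
diffIs : (v : ℕ) → Fin (2 ℕ.* v) → Fin (2 ℕ.* v) → Fin (2 ℕ.* v) → Bool
diffIs v i j m =
  does (toℕ j ℕ.+ toℕ m ℕ.≟ toℕ i)
  Data.Bool.∨ does (toℕ j ℕ.+ toℕ m ℕ.≟ toℕ i ℕ.+ 2 ℕ.* v)

boolToℕ : Bool → ℕ
boolToℕ true = 1
boolToℕ false = 0

pairCount : (v : ℕ) → Subset2 v → Fin (2 ℕ.* v) → ℕ
pairCount v X m =
  Σℕ (2 ℕ.* v) (λ i → Σℕ (2 ℕ.* v) (λ j →
    boolToℕ (X i ∧ X j ∧ diffIs v i j m)))

tripleCount : (v : ℕ) → List (Subset2 v) → Fin (2 ℕ.* v) → ℕ
tripleCount v Xs m = foldr ℕ._+_ 0 (map (λ X → pairCount v X m) Xs)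

-- relative difference family in Z_{2v} (relative to the subgroup {0, v}) with parameter λ
IsRelDiffFamily : (v : ℕ) → List (Subset2 v) → ℕ → Set
IsRelDiffFamily v Xs λ' =
  (∀ m → ¬ (toℕ m ≡ 0) → ¬ (toℕ m ≡ v) → tripleCount v Xs m ≡ λ')
  × (∀ m → toℕ m ≡ v → tripleCount v Xs m ≡ 0)

-- Write v = w + 1 and c = 2v - 1, so that adding c to an index subtracts 1
-- modulo 2v.  A binary sequence a of length v extends to the negaperiodic
-- function A = ext a : ℕ → ℤ, A(qv + r) = (-1)^q a_r, which satisfies
-- A(y + v) = -A(y).  Three facts about A drive the proof:
--   * the negacyclic shift matrix N translates A by c, so NAF_a(k) is the
--     autocorrelation corr A k = Σ_{y<v} A(y) A(y + kc)          (NAF≡corr);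
--   * read as a ±1 sequence, the subset Φ_v(a) ⊆ ℤ_{2v} is A on {0,…,2v-1}
--     (Φ-ext), and for such a subset the number P(m) of pairs with
--     difference m satisfies 2·P(m) = v + corr A m            (pairCount-corr);
--   * corr A (v + k) = -corr A k and corr A v = -v      (corr-shift, corr-v).
-- For a Golay pair the correlations of a and b cancel at every m ∉ {0, v},
-- so the two pair counts add up to v there, while at m = v they vanish.
module Submission where

open import Defs
open import Data.Nat as ℕ using (ℕ; zero; suc; _≤_; _∸_)
import Data.Nat.Properties as ℕP
open import Data.Nat.DivMod using (_/_; m%n<n; [m+n]%n≡m%n; m/n≡1+[m∸n]/n; m<n⇒m%n≡m; m<n⇒m/n≡0)
open import Data.Nat.Tactic.RingSolver using (solve-∀)
open import Data.Integer using (ℤ; +_; 0ℤ; 1ℤ; -1ℤ; _+_; _*_; -_; _^_)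
import Data.Integer.Properties as ℤP
import Data.Integer.Tactic.RingSolver as ℤ-Ring
open import Data.Fin using (Fin; zero; suc; toℕ; fromℕ<; fromℕ; inject₁; punchIn)
open import Data.Fin.Properties using (toℕ-injective; toℕ-fromℕ<; toℕ-fromℕ; toℕ-inject₁; toℕ<n; punchInᵢ≢i)
open import Data.List as List using (_∷_; []; foldr; tabulate)
open import Data.List.Properties using (map-tabulate)
open import Data.Bool using (Bool; true; false; _∧_; if_then_else_)
open import Data.Bool.Properties using (∧-zeroʳ; ∨-zeroʳ)
open import Data.Sign as Sign using (Sign)
open import Data.Sum using (_⊎_; inj₁; inj₂)
open import Data.Product using (Σ; _,_; proj₁; proj₂)
open import Function using (_∘_; id)
open import Relation.Nullary using (does; yes; no; ¬_; contradiction)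
open import Relation.Nullary.Decidable using (dec-true; dec-false)
open import Relation.Binary.PropositionalEquality
open import Algebra.Properties.Semiring.Sum ℤP.+-*-semiring
  using (sum; sum-cong-≗; ∑-distrib-+; ∑-comm; *-distribˡ-sum; *-distribʳ-sum; sum-remove; sum-replicate-zero)
open ≡-Reasoning

Σℤ≡sum : ∀ n (f : Fin n → ℤ) → Σℤ n f ≡ sum f
Σℤ≡sum zero    f = refl
Σℤ≡sum (suc n) f = cong (λ s → f zero + s) (begin
  foldr _+_ 0ℤ (List.map f (tabulate suc))   ≡⟨ cong (foldr _+_ 0ℤ) (map-tabulate suc f) ⟩
  foldr _+_ 0ℤ (tabulate (f ∘ suc))          ≡⟨ cong (foldr _+_ 0ℤ) (map-tabulate id (f ∘ suc)) ⟨
  Σℤ n (f ∘ suc)                             ≡⟨ Σℤ≡sum n (f ∘ suc) ⟩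
  sum (f ∘ suc)                              ∎)

Σℕ≡sum : ∀ n (f : Fin n → ℕ) → + Σℕ n f ≡ sum (λ i → + f i)
Σℕ≡sum zero    f = refl
Σℕ≡sum (suc n) f = begin
  + (f zero ℕ.+ foldr ℕ._+_ 0 (List.map f (tabulate suc)))   ≡⟨ ℤP.pos-+ (f zero) _ ⟩
  + f zero + + foldr ℕ._+_ 0 (List.map f (tabulate suc))     ≡⟨ cong (λ l → + f zero + + foldr ℕ._+_ 0 l) (trans (map-tabulate suc f) (sym (map-tabulate id (f ∘ suc)))) ⟩
  + f zero + + Σℕ n (f ∘ suc)                                ≡⟨ cong (λ s → + f zero + s) (Σℕ≡sum n (f ∘ suc)) ⟩
  + f zero + sum (λ i → + f (suc i))                         ∎

sum-single : ∀ {n} (f : Fin n → ℤ) (i₀ : Fin n) → (∀ i → i ≢ i₀ → f i ≡ 0ℤ) → sum f ≡ f i₀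
sum-single {suc n} f i₀ vanish = begin
  sum f                          ≡⟨ sum-remove {i = i₀} f ⟩
  f i₀ + sum (f ∘ punchIn i₀)    ≡⟨ cong (λ s → f i₀ + s) (sum-cong-≗ (λ j → vanish _ (punchInᵢ≢i i₀ j))) ⟩
  f i₀ + sum {n} (λ _ → 0ℤ)      ≡⟨ cong (λ s → f i₀ + s) (sum-replicate-zero n) ⟩
  f i₀ + 0ℤ                      ≡⟨ ℤP.+-identityʳ (f i₀) ⟩
  f i₀                           ∎

sum-const : ∀ n x → sum {n} (λ _ → x) ≡ + n * x
sum-const zero    x = refl
sum-const (suc n) x = begin
  x + sum {n} (λ _ → x)   ≡⟨ cong (λ s → x + s) (sum-const n x) ⟩
  x + + n * x             ≡⟨ cong (_+ + n * x) (ℤP.*-identityˡ x) ⟨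
  1ℤ * x + + n * x        ≡⟨ ℤP.*-distribʳ-+ x 1ℤ (+ n) ⟨
  + suc n * x             ∎

sum-neg : ∀ {n} (f : Fin n → ℤ) → sum (λ i → - f i) ≡ - sum f
sum-neg f = begin
  sum (λ i → - f i)        ≡⟨ sum-cong-≗ (λ i → sym (ℤP.-1*i≡-i (f i))) ⟩
  sum (λ i → -1ℤ * f i)    ≡⟨ *-distribˡ-sum -1ℤ f ⟨
  -1ℤ * sum f              ≡⟨ ℤP.-1*i≡-i (sum f) ⟩
  - sum f                  ∎

∑< : ℕ → (ℕ → ℤ) → ℤ
∑< n F = sum {n} (F ∘ toℕ)

∑<-split : ∀ m n (F : ℕ → ℤ) → ∑< (m ℕ.+ n) F ≡ ∑< m F + ∑< n (λ y → F (m ℕ.+ y))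
∑<-split zero    n F = sym (ℤP.+-identityˡ _)
∑<-split (suc m) n F = trans (cong (λ s → F 0 + s) (∑<-split m n (F ∘ suc))) (sym (ℤP.+-assoc (F 0) _ _))

⊛≡sum : ∀ {v} (x : Vecℤ v) (M : Mat v) j → (x ⊛ M) j ≡ sum (λ i → x i * M i j)
⊛≡sum {v} x M j = Σℤ≡sum v (λ i → x i * M i j)

⊛-⊗ : ∀ {v} (x : Vecℤ v) (P Q : Mat v) j → (x ⊛ (P ⊗ Q)) j ≡ ((x ⊛ P) ⊛ Q) j
⊛-⊗ {v} x P Q j = begin
  (x ⊛ (P ⊗ Q)) j
    ≡⟨ ⊛≡sum x (P ⊗ Q) j ⟩
  sum (λ i → x i * Σℤ v (λ k → P i k * Q k j))
    ≡⟨ sum-cong-≗ (λ i → trans (cong (x i *_) (Σℤ≡sum v (λ k → P i k * Q k j))) (*-distribˡ-sum (x i) (λ k → P i k * Q k j))) ⟩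
  sum (λ i → sum (λ k → x i * (P i k * Q k j)))
    ≡⟨ ∑-comm (λ i k → x i * (P i k * Q k j)) ⟩
  sum (λ k → sum (λ i → x i * (P i k * Q k j)))
    ≡⟨ sum-cong-≗ (λ k → sum-cong-≗ (λ i → sym (ℤP.*-assoc (x i) (P i k) (Q k j)))) ⟩
  sum (λ k → sum (λ i → (x i * P i k) * Q k j))
    ≡⟨ sum-cong-≗ (λ k → trans (sym (*-distribʳ-sum (Q k j) (λ i → x i * P i k))) (cong (_* Q k j) (sym (⊛≡sum x P k)))) ⟩
  sum (λ k → (x ⊛ P) k * Q k j)
    ≡⟨ ⊛≡sum (x ⊛ P) Q j ⟨
  ((x ⊛ P) ⊛ Q) j ∎

⊛-congˡ : ∀ {v} {x y : Vecℤ v} (M : Mat v) → (∀ i → x i ≡ y i) → ∀ j → (x ⊛ M) j ≡ (y ⊛ M) j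
⊛-congˡ {v} {x} {y} M x≗y j = begin
  (x ⊛ M) j                    ≡⟨ ⊛≡sum x M j ⟩
  sum (λ i → x i * M i j)      ≡⟨ sum-cong-≗ (λ i → cong (_* M i j) (x≗y i)) ⟩
  sum (λ i → y i * M i j)      ≡⟨ ⊛≡sum y M j ⟨
  (y ⊛ M) j                    ∎

⊛-idMat : ∀ {v} (x : Vecℤ v) j → (x ⊛ idMat) j ≡ x j
⊛-idMat {v} x j = begin
  (x ⊛ idMat) j                ≡⟨ ⊛≡sum x idMat j ⟩
  sum (λ i → x i * idMat i j)  ≡⟨ sum-single _ j offDiagonal ⟩
  x j * idMat j j              ≡⟨ cong (λ b → x j * (if b then 1ℤ else 0ℤ)) (dec-true (toℕ j ℕ.≟ toℕ j) refl) ⟩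
  x j * 1ℤ                     ≡⟨ ℤP.*-identityʳ (x j) ⟩
  x j                          ∎
  where
  offDiagonal : ∀ i → i ≢ j → x i * idMat i j ≡ 0ℤ
  offDiagonal i i≢j rewrite dec-false (toℕ i ℕ.≟ toℕ j) (i≢j ∘ toℕ-injective) = ℤP.*-zeroʳ (x i)

-- j represents i - m in ℤ_n, for representatives i, j, m ∈ {0,…,n-1}.
IsDiff : ℕ → ℕ → ℕ → ℕ → Set
IsDiff n i j m = (j ℕ.+ m ≡ i) ⊎ (j ℕ.+ m ≡ i ℕ.+ n)

diff-exists : ∀ {n} (i m : Fin n) → Σ (Fin n) (λ j → IsDiff n (toℕ i) (toℕ j) (toℕ m))
diff-exists {n} i m with toℕ m ℕ.≤? toℕ i
... | yes m≤i = fromℕ< i∸m<n , inj₁ (trans (cong (ℕ._+ toℕ m) (toℕ-fromℕ< i∸m<n)) (ℕP.m∸n+n≡m m≤i))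
  where
  i∸m<n : toℕ i ∸ toℕ m ℕ.< n
  i∸m<n = ℕP.≤-<-trans (ℕP.m∸n≤m (toℕ i) (toℕ m)) (toℕ<n i)
... | no m≰i = fromℕ< i+n∸m<n , inj₂ (trans (cong (ℕ._+ toℕ m) (toℕ-fromℕ< i+n∸m<n)) (ℕP.m∸n+n≡m m≤i+n))
  where
  m≤i+n : toℕ m ℕ.≤ toℕ i ℕ.+ n
  m≤i+n = ℕP.≤-trans (ℕP.<⇒≤ (toℕ<n m)) (ℕP.m≤n+m n (toℕ i))
  i+n∸m<n : toℕ i ℕ.+ n ∸ toℕ m ℕ.< n
  i+n∸m<n = subst (toℕ i ℕ.+ n ∸ toℕ m ℕ.<_) (ℕP.m+n∸m≡n (toℕ i) n) (ℕP.∸-monoʳ-< (ℕP.≰⇒> m≰i) m≤i+n)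

overshoot : ∀ {n i j j′ m} → j ℕ.+ m ≡ i → j′ ℕ.+ m ≡ i ℕ.+ n → n ℕ.≤ j′
overshoot {n} {i} {j} {j′} {m} e e′ = subst (n ℕ.≤_) (sym j′≡j+n) (ℕP.m≤n+m n j)
  where
  swap : ∀ x y z → x ℕ.+ y ℕ.+ z ≡ x ℕ.+ z ℕ.+ y
  swap = solve-∀
  j′≡j+n : j′ ≡ j ℕ.+ n
  j′≡j+n = ℕP.+-cancelʳ-≡ m j′ (j ℕ.+ n) (trans e′ (trans (cong (ℕ._+ n) (sym e)) (swap j m n)))

diff-unique : ∀ {n i j j′ m} → j ℕ.< n → j′ ℕ.< n → IsDiff n i j m → IsDiff n i j′ m → j ≡ j′
diff-unique _   _    (inj₁ e) (inj₁ e′) = ℕP.+-cancelʳ-≡ _ _ _ (trans e (sym e′))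
diff-unique _   _    (inj₂ e) (inj₂ e′) = ℕP.+-cancelʳ-≡ _ _ _ (trans e (sym e′))
diff-unique _   j′<n (inj₁ e) (inj₂ e′) = contradiction j′<n (ℕP.≤⇒≯ (overshoot e e′))
diff-unique j<n _    (inj₂ e) (inj₁ e′) = contradiction j<n (ℕP.≤⇒≯ (overshoot e′ e))

diffIs-false : ∀ v (i j m : Fin (2 ℕ.* v)) → ¬ IsDiff (2 ℕ.* v) (toℕ i) (toℕ j) (toℕ m) → diffIs v i j m ≡ false
diffIs-false v i j m ¬diff
  rewrite dec-false (toℕ j ℕ.+ toℕ m ℕ.≟ toℕ i) (¬diff ∘ inj₁)
        | dec-false (toℕ j ℕ.+ toℕ m ℕ.≟ toℕ i ℕ.+ 2 ℕ.* v) (¬diff ∘ inj₂) = refl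

diffIs-true : ∀ v (i j m : Fin (2 ℕ.* v)) → IsDiff (2 ℕ.* v) (toℕ i) (toℕ j) (toℕ m) → diffIs v i j m ≡ true
diffIs-true v i j m (inj₁ e) rewrite dec-true (toℕ j ℕ.+ toℕ m ℕ.≟ toℕ i) e = refl
diffIs-true v i j m (inj₂ e) rewrite dec-true (toℕ j ℕ.+ toℕ m ℕ.≟ toℕ i ℕ.+ 2 ℕ.* v) e = ∨-zeroʳ _

-- Membership in a subset read as ±1.
σ : Bool → ℤ
σ true  = 1ℤ
σ false = -1ℤ

σ-isPlus : ∀ s → σ (isPlus s) ≡ val s
σ-isPlus Sign.+ = refl
σ-isPlus Sign.- = refl

σ-isMinus : ∀ s → σ (isMinus s) ≡ - val s
σ-isMinus Sign.+ = refl
σ-isMinus Sign.- = refl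

indicator-∧ : ∀ b d → + 4 * + boolToℕ (b ∧ d ∧ true) ≡ (1ℤ + σ b) * (1ℤ + σ d)
indicator-∧ true  true  = refl
indicator-∧ true  false = refl
indicator-∧ false true  = refl
indicator-∧ false false = refl

-- The constant c = 2v - 1 is a
-- translation by -1 modulo 2v, which avoids subtraction of indices.
module Negaperiodic (w : ℕ) where

  v c : ℕ
  v = suc w
  c = v ℕ.+ w

  IsNegaperiodic : (ℕ → ℤ) → Set
  IsNegaperiodic G = ∀ y → G (y ℕ.+ v) ≡ - G y

  module _ {G : ℕ → ℤ} (G-neg : IsNegaperiodic G) where

    periodic : ∀ y → G (y ℕ.+ v ℕ.+ v) ≡ G y
    periodic y = trans (G-neg (y ℕ.+ v)) (trans (cong -_ (G-neg y)) (ℤP.neg-involutive (G y)))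

    periodic* : ∀ t y → G (y ℕ.+ t ℕ.* (v ℕ.+ v)) ≡ G y
    periodic* zero    y = cong G (ℕP.+-identityʳ y)
    periodic* (suc t) y = begin
      G (y ℕ.+ (v ℕ.+ v ℕ.+ t ℕ.* (v ℕ.+ v)))   ≡⟨ cong G (regroup y t w) ⟩
      G (y ℕ.+ t ℕ.* (v ℕ.+ v) ℕ.+ v ℕ.+ v)     ≡⟨ periodic _ ⟩
      G (y ℕ.+ t ℕ.* (v ℕ.+ v))                 ≡⟨ periodic* t y ⟩
      G y                                       ∎
      where
      regroup : ∀ y t w → y ℕ.+ (suc w ℕ.+ suc w ℕ.+ t ℕ.* (suc w ℕ.+ suc w))
                        ≡ y ℕ.+ t ℕ.* (suc w ℕ.+ suc w) ℕ.+ suc w ℕ.+ suc w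
      regroup = solve-∀

    -- … so a shift by v·c ≡ v (mod 2v) changes its sign.
    shift-vc : ∀ y → G (y ℕ.+ v ℕ.* c) ≡ - G y
    shift-vc y = begin
      G (y ℕ.+ v ℕ.* c)                         ≡⟨ ℤP.neg-involutive _ ⟨
      - - G (y ℕ.+ v ℕ.* c)                     ≡⟨ cong -_ (G-neg (y ℕ.+ v ℕ.* c)) ⟨
      - G (y ℕ.+ v ℕ.* c ℕ.+ v)                 ≡⟨ cong (λ z → - G z) (regroup y w) ⟩
      - G (y ℕ.+ v ℕ.* (v ℕ.+ v))               ≡⟨ cong -_ (periodic* v y) ⟩
      - G y                                     ∎
      where
      regroup : ∀ y w → y ℕ.+ suc w ℕ.* (suc w ℕ.+ w) ℕ.+ suc w ≡ y ℕ.+ suc w ℕ.* (suc w ℕ.+ suc w)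
      regroup = solve-∀

    translate : ∀ d → IsNegaperiodic (λ y → G (y ℕ.+ d))
    translate d y = trans (cong G (swap y v d)) (G-neg (y ℕ.+ d))
      where
      swap : ∀ x y z → x ℕ.+ y ℕ.+ z ≡ x ℕ.+ z ℕ.+ y
      swap = solve-∀

    diff-translate : ∀ {i j m} → IsDiff (2 ℕ.* v) i j m → G j ≡ G (i ℕ.+ m ℕ.* c)
    diff-translate {i} {j} {m} diff = begin
      G j                                  ≡⟨ periodic* m j ⟨
      G (j ℕ.+ m ℕ.* (v ℕ.+ v))            ≡⟨ cong G (regroup j m w) ⟩
      G (j ℕ.+ m ℕ.+ m ℕ.* c)              ≡⟨ wrap diff ⟩
      G (i ℕ.+ m ℕ.* c)                    ∎
      where
      regroup : ∀ j m w → j ℕ.+ m ℕ.* (suc w ℕ.+ suc w) ≡ j ℕ.+ m ℕ.+ m ℕ.* (suc w ℕ.+ w)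
      regroup = solve-∀
      regroup₂ : ∀ i d w → i ℕ.+ 2 ℕ.* suc w ℕ.+ d ≡ i ℕ.+ d ℕ.+ suc w ℕ.+ suc w
      regroup₂ = solve-∀
      wrap : IsDiff (2 ℕ.* v) i j m → G (j ℕ.+ m ℕ.+ m ℕ.* c) ≡ G (i ℕ.+ m ℕ.* c)
      wrap (inj₁ e) = cong (λ z → G (z ℕ.+ m ℕ.* c)) e
      wrap (inj₂ e) = begin
        G (j ℕ.+ m ℕ.+ m ℕ.* c)              ≡⟨ cong (λ z → G (z ℕ.+ m ℕ.* c)) e ⟩
        G (i ℕ.+ 2 ℕ.* v ℕ.+ m ℕ.* c)        ≡⟨ cong G (regroup₂ i (m ℕ.* c) w) ⟩
        G (i ℕ.+ m ℕ.* c ℕ.+ v ℕ.+ v)        ≡⟨ periodic (i ℕ.+ m ℕ.* c) ⟩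
        G (i ℕ.+ m ℕ.* c)                    ∎

  N : Mat v
  N = negaShift v

  N-col₀ : ∀ i → i ≢ fromℕ w → N i zero ≡ 0ℤ
  N-col₀ i i≢last rewrite dec-false (toℕ i ℕ.≟ w) (λ e → i≢last (toℕ-injective (trans e (sym (toℕ-fromℕ w))))) = refl

  N-last : N (fromℕ w) zero ≡ -1ℤ
  N-last rewrite dec-true (toℕ (fromℕ w) ℕ.≟ w) (toℕ-fromℕ w) = refl

  N-col : ∀ j i → i ≢ inject₁ j → N i (suc j) ≡ 0ℤ
  N-col j i i≢j
    rewrite dec-false (suc (toℕ j) ℕ.≟ suc (toℕ i)) (λ e → i≢j (toℕ-injective (trans (sym (ℕP.suc-injective e)) (sym (toℕ-inject₁ j)))))
          | ∧-zeroʳ (does (toℕ i ℕ.≟ w)) = refl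

  N-diag : ∀ j → N (inject₁ j) (suc j) ≡ 1ℤ
  N-diag j rewrite dec-true (suc (toℕ j) ℕ.≟ suc (toℕ (inject₁ j))) (cong suc (sym (toℕ-inject₁ j))) = refl

  vec : (ℕ → ℤ) → Vecℤ v
  vec G i = G (toℕ i)

  ⊛-N : ∀ {G} → IsNegaperiodic G → ∀ j → (vec G ⊛ N) j ≡ G (toℕ j ℕ.+ c)
  ⊛-N {G} G-neg zero = begin
    (vec G ⊛ N) zero                        ≡⟨ ⊛≡sum (vec G) N zero ⟩
    sum (λ i → G (toℕ i) * N i zero)        ≡⟨ sum-single _ (fromℕ w) (λ i i≢last → trans (cong (G (toℕ i) *_) (N-col₀ i i≢last)) (ℤP.*-zeroʳ (G (toℕ i)))) ⟩
    G (toℕ (fromℕ w)) * N (fromℕ w) zero    ≡⟨ cong₂ _*_ (cong G (toℕ-fromℕ w)) N-last ⟩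
    G w * -1ℤ                               ≡⟨ ℤP.*-comm (G w) -1ℤ ⟩
    -1ℤ * G w                               ≡⟨ ℤP.-1*i≡-i (G w) ⟩
    - G w                                   ≡⟨ G-neg w ⟨
    G (w ℕ.+ v)                             ≡⟨ cong G (ℕP.+-comm w v) ⟩
    G c                                     ∎
  ⊛-N {G} G-neg (suc j) = begin
    (vec G ⊛ N) (suc j)                          ≡⟨ ⊛≡sum (vec G) N (suc j) ⟩
    sum (λ i → G (toℕ i) * N i (suc j))          ≡⟨ sum-single _ (inject₁ j) (λ i i≢j → trans (cong (G (toℕ i) *_) (N-col j i i≢j)) (ℤP.*-zeroʳ (G (toℕ i)))) ⟩
    G (toℕ (inject₁ j)) * N (inject₁ j) (suc j)  ≡⟨ cong₂ _*_ (cong G (toℕ-inject₁ j)) (N-diag j) ⟩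
    G (toℕ j) * 1ℤ                               ≡⟨ ℤP.*-identityʳ _ ⟩
    G (toℕ j)                                    ≡⟨ periodic G-neg (toℕ j) ⟨
    G (toℕ j ℕ.+ v ℕ.+ v)                        ≡⟨ cong G (regroup (toℕ j) w) ⟩
    G (suc (toℕ j) ℕ.+ c)                        ∎
    where
    regroup : ∀ j w → j ℕ.+ suc w ℕ.+ suc w ≡ suc j ℕ.+ (suc w ℕ.+ w)
    regroup = solve-∀

  ⊛-N^ : ∀ {G} → IsNegaperiodic G → ∀ k j → (vec G ⊛ (N ^ᴹ k)) j ≡ G (toℕ j ℕ.+ k ℕ.* c)
  ⊛-N^ {G} G-neg zero j = trans (⊛-idMat (vec G) j) (cong G (sym (ℕP.+-identityʳ (toℕ j))))
  ⊛-N^ {G} G-neg (suc k) j = begin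
    (vec G ⊛ (N ⊗ (N ^ᴹ k))) j               ≡⟨ ⊛-⊗ (vec G) N (N ^ᴹ k) j ⟩
    ((vec G ⊛ N) ⊛ (N ^ᴹ k)) j               ≡⟨ ⊛-congˡ (N ^ᴹ k) (⊛-N G-neg) j ⟩
    (vec (λ y → G (y ℕ.+ c)) ⊛ (N ^ᴹ k)) j   ≡⟨ ⊛-N^ (translate G-neg c) k j ⟩
    G (toℕ j ℕ.+ k ℕ.* c ℕ.+ c)              ≡⟨ cong G (regroup (toℕ j) k c) ⟩
    G (toℕ j ℕ.+ suc k ℕ.* c)                ∎
    where
    regroup : ∀ j k c → j ℕ.+ k ℕ.* c ℕ.+ c ≡ j ℕ.+ (c ℕ.+ k ℕ.* c)
    regroup = solve-∀

  -- Summing a product over a full period {0,…,2v-1} pairs y with y + v.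
  pairing : ∀ {G H} → IsNegaperiodic G → IsNegaperiodic H →
            ∑< (v ℕ.+ v) (λ y → (1ℤ + G y) * (1ℤ + H y)) ≡ + 2 * (+ v + ∑< v (λ y → G y * H y))
  pairing {G} {H} G-neg H-neg = begin
    ∑< (v ℕ.+ v) F                                        ≡⟨ ∑<-split v v F ⟩
    ∑< v F + ∑< v (λ y → F (v ℕ.+ y))                     ≡⟨ ∑-distrib-+ {v} (F ∘ toℕ) (λ y → F (v ℕ.+ toℕ y)) ⟨
    ∑< v (λ y → F y + F (v ℕ.+ y))                        ≡⟨ sum-cong-≗ {v} (λ y → pair (toℕ y)) ⟩
    ∑< v (λ y → + 2 + + 2 * (G y * H y))                  ≡⟨ ∑-distrib-+ {v} (λ _ → + 2) (λ y → + 2 * (G (toℕ y) * H (toℕ y))) ⟩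
    sum {v} (λ _ → + 2) + ∑< v (λ y → + 2 * (G y * H y))  ≡⟨ cong₂ _+_ (sum-const v (+ 2)) (sym (*-distribˡ-sum {v} (+ 2) (λ y → G (toℕ y) * H (toℕ y)))) ⟩
    + v * + 2 + + 2 * ∑< v (λ y → G y * H y)              ≡⟨ factor (+ v) (∑< v (λ y → G y * H y)) ⟩
    + 2 * (+ v + ∑< v (λ y → G y * H y))                  ∎
    where
    F : ℕ → ℤ
    F y = (1ℤ + G y) * (1ℤ + H y)
    expand : ∀ p q → (1ℤ + p) * (1ℤ + q) + (1ℤ + - p) * (1ℤ + - q) ≡ + 2 + + 2 * (p * q)
    expand = ℤ-Ring.solve-∀
    factor : ∀ n s → n * + 2 + + 2 * s ≡ + 2 * (n + s)
    factor = ℤ-Ring.solve-∀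
    pair : ∀ y → F y + F (v ℕ.+ y) ≡ + 2 + + 2 * (G y * H y)
    pair y = begin
      F y + F (v ℕ.+ y)                                 ≡⟨ cong (λ s → F y + s) (cong₂ (λ p q → (1ℤ + p) * (1ℤ + q))
                                                              (trans (cong G (ℕP.+-comm v y)) (G-neg y))
                                                              (trans (cong H (ℕP.+-comm v y)) (H-neg y))) ⟩
      F y + (1ℤ + - G y) * (1ℤ + - H y)                 ≡⟨ expand (G y) (H y) ⟩
      + 2 + + 2 * (G y * H y)                           ∎

  corr : (ℕ → ℤ) → ℕ → ℤ
  corr G k = ∑< v (λ y → G y * G (y ℕ.+ k ℕ.* c))

  corr-shift : ∀ {G} → IsNegaperiodic G → ∀ k → corr G (v ℕ.+ k) ≡ - corr G k
  corr-shift {G} G-neg k = trans (sum-cong-≗ {v} (negated ∘ toℕ)) (sum-neg {v} (λ y → G (toℕ y) * G (toℕ y ℕ.+ k ℕ.* c)))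
    where
    regroup : ∀ y k v c → y ℕ.+ (v ℕ.+ k) ℕ.* c ≡ y ℕ.+ k ℕ.* c ℕ.+ v ℕ.* c
    regroup = solve-∀
    negated : ∀ y → G y * G (y ℕ.+ (v ℕ.+ k) ℕ.* c) ≡ - (G y * G (y ℕ.+ k ℕ.* c))
    negated y = begin
      G y * G (y ℕ.+ (v ℕ.+ k) ℕ.* c)      ≡⟨ cong (λ z → G y * G z) (regroup y k v c) ⟩
      G y * G (y ℕ.+ k ℕ.* c ℕ.+ v ℕ.* c)  ≡⟨ cong (G y *_) (shift-vc G-neg (y ℕ.+ k ℕ.* c)) ⟩
      G y * - G (y ℕ.+ k ℕ.* c)            ≡⟨ ℤP.neg-distribʳ-* (G y) _ ⟨
      - (G y * G (y ℕ.+ k ℕ.* c))          ∎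

  corr-zero : ∀ {G} → (∀ y → G y * G y ≡ 1ℤ) → corr G 0 ≡ + v
  corr-zero {G} G²≡1 = begin
    ∑< v (λ y → G y * G (y ℕ.+ 0))   ≡⟨ sum-cong-≗ {v} (λ y → trans (cong (λ z → G (toℕ y) * G z) (ℕP.+-identityʳ (toℕ y))) (G²≡1 (toℕ y))) ⟩
    sum {v} (λ _ → 1ℤ)               ≡⟨ sum-const v 1ℤ ⟩
    + v * 1ℤ                         ≡⟨ ℤP.*-identityʳ (+ v) ⟩
    + v                              ∎

  corr-v : ∀ {G} → IsNegaperiodic G → (∀ y → G y * G y ≡ 1ℤ) → corr G v ≡ - + v
  corr-v {G} G-neg G²≡1 = begin
    corr G v              ≡⟨ cong (corr G) (ℕP.+-identityʳ v) ⟨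
    corr G (v ℕ.+ 0)      ≡⟨ corr-shift {G} G-neg 0 ⟩
    - corr G 0            ≡⟨ cong -_ (corr-zero {G} G²≡1) ⟩
    - + v                 ∎

  toℕ<v+v : ∀ (x : Fin (2 ℕ.* v)) → toℕ x ℕ.< v ℕ.+ v
  toℕ<v+v x = subst (toℕ x ℕ.<_) (cong (v ℕ.+_) (ℕP.+-identityʳ v)) (toℕ<n x)

  ext : BinSeq v → ℕ → ℤ
  ext a y = -1ℤ ^ (y / v) * val (a (fromℕ< (m%n<n y v)))

  module _ (a : BinSeq v) where

    -- Translation by v increases the quotient by one and keeps the remainder.
    ext-neg : IsNegaperiodic (ext a)
    ext-neg y = begin
      -1ℤ ^ ((y ℕ.+ v) / v) * val (a (fromℕ< (m%n<n (y ℕ.+ v) v)))  ≡⟨ cong₂ (λ q r → -1ℤ ^ q * val (a r)) quotient remainder ⟩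
      -1ℤ * -1ℤ ^ (y / v) * val (a (fromℕ< (m%n<n y v)))            ≡⟨ ℤP.*-assoc -1ℤ (-1ℤ ^ (y / v)) (val (a (fromℕ< (m%n<n y v)))) ⟩
      -1ℤ * ext a y                                                  ≡⟨ ℤP.-1*i≡-i (ext a y) ⟩
      - ext a y                                                      ∎
      where
      quotient : (y ℕ.+ v) / v ≡ suc (y / v)
      quotient = trans (m/n≡1+[m∸n]/n (ℕP.m≤n+m v y)) (cong (λ z → suc (z / v)) (ℕP.m+n∸n≡m y v))
      remainder : fromℕ< (m%n<n (y ℕ.+ v) v) ≡ fromℕ< (m%n<n y v)
      remainder = toℕ-injective (trans (toℕ-fromℕ< _) (trans ([m+n]%n≡m%n y v) (sym (toℕ-fromℕ< _))))

    ext-restrict : ∀ i → ext a (toℕ i) ≡ val (a i)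
    ext-restrict i = begin
      -1ℤ ^ (toℕ i / v) * val (a (fromℕ< (m%n<n (toℕ i) v)))  ≡⟨ cong₂ (λ q r → -1ℤ ^ q * val (a r)) (m<n⇒m/n≡0 (toℕ<n i)) index ⟩
      1ℤ * val (a i)                                           ≡⟨ ℤP.*-identityˡ _ ⟩
      val (a i)                                                ∎
      where
      index : fromℕ< (m%n<n (toℕ i) v) ≡ i
      index = toℕ-injective (trans (toℕ-fromℕ< _) (m<n⇒m%n≡m (toℕ<n i)))

    ext-sq : ∀ y → ext a y * ext a y ≡ 1ℤ
    ext-sq y = trans (rearrange (-1ℤ ^ (y / v)) (val (a _))) (cong₂ _*_ (±1-sq (y / v)) (val-sq (a _)))
      where
      rearrange : ∀ p s → (p * s) * (p * s) ≡ (p * p) * (s * s)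
      rearrange = ℤ-Ring.solve-∀
      ±1-sq : ∀ q → -1ℤ ^ q * -1ℤ ^ q ≡ 1ℤ
      ±1-sq zero    = refl
      ±1-sq (suc q) = trans (signs-cancel (-1ℤ ^ q)) (±1-sq q)
        where
        signs-cancel : ∀ p → (-1ℤ * p) * (-1ℤ * p) ≡ p * p
        signs-cancel = ℤ-Ring.solve-∀
      val-sq : ∀ s → val s * val s ≡ 1ℤ
      val-sq Sign.+ = refl
      val-sq Sign.- = refl

    NAF≡corr : ∀ k → NAF a k ≡ corr (ext a) k
    NAF≡corr k = trans (Σℤ≡sum v (λ i → val (a i) * ((λ j → val (a j)) ⊛ (N ^ᴹ k)) i)) (sum-cong-≗ {v} term)
      where
      term : ∀ i → val (a i) * ((λ j → val (a j)) ⊛ (N ^ᴹ k)) i ≡ ext a (toℕ i) * ext a (toℕ i ℕ.+ k ℕ.* c)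
      term i = cong₂ _*_ (sym (ext-restrict i))
                         (trans (⊛-congˡ (N ^ᴹ k) (sym ∘ ext-restrict) i) (⊛-N^ ext-neg k i))

    Φ-ext : ∀ x → σ (Φ v a x) ≡ ext a (toℕ x)
    Φ-ext x with toℕ x ℕ.<? v
    ... | yes x<v = begin
      σ (isPlus (a (fromℕ< x<v)))     ≡⟨ σ-isPlus (a (fromℕ< x<v)) ⟩
      val (a (fromℕ< x<v))            ≡⟨ ext-restrict (fromℕ< x<v) ⟨
      ext a (toℕ (fromℕ< x<v))        ≡⟨ cong (ext a) (toℕ-fromℕ< x<v) ⟩
      ext a (toℕ x)                   ∎
    ... | no x≮v with toℕ x ∸ v ℕ.<? v
    ...   | yes x-v<v = begin
      σ (isMinus (a (fromℕ< x-v<v)))  ≡⟨ σ-isMinus (a (fromℕ< x-v<v)) ⟩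
      - val (a (fromℕ< x-v<v))        ≡⟨ cong -_ (ext-restrict (fromℕ< x-v<v)) ⟨
      - ext a (toℕ (fromℕ< x-v<v))    ≡⟨ cong (λ z → - ext a z) (toℕ-fromℕ< x-v<v) ⟩
      - ext a (toℕ x ∸ v)             ≡⟨ ext-neg (toℕ x ∸ v) ⟨
      ext a (toℕ x ∸ v ℕ.+ v)         ≡⟨ cong (ext a) (ℕP.m∸n+n≡m (ℕP.≮⇒≥ x≮v)) ⟩
      ext a (toℕ x)                   ∎
    ...   | no x-v≮v = contradiction (ℕP.m<n+o⇒m∸n<o (toℕ x) v (toℕ<v+v x)) x-v≮v

  module PairCount (X : Subset2 v) {G : ℕ → ℤ} (G-neg : IsNegaperiodic G)
                   (X≗G : ∀ x → σ (X x) ≡ G (toℕ x)) where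

    partner : Fin (2 ℕ.* v) → Fin (2 ℕ.* v) → Fin (2 ℕ.* v)
    partner i m = proj₁ (diff-exists i m)

    partner-diff : ∀ i m → IsDiff (2 ℕ.* v) (toℕ i) (toℕ (partner i m)) (toℕ m)
    partner-diff i m = proj₂ (diff-exists i m)

    pairCount-partner : ∀ m → + pairCount v X m ≡ sum {2 ℕ.* v} (λ i → + boolToℕ (X i ∧ X (partner i m) ∧ true))
    pairCount-partner m = begin
      + pairCount v X m                          ≡⟨ Σℕ≡sum (2 ℕ.* v) (λ i → Σℕ (2 ℕ.* v) (counted i)) ⟩
      sum {2 ℕ.* v} (λ i → + Σℕ (2 ℕ.* v) (counted i))
        ≡⟨ sum-cong-≗ {2 ℕ.* v} (λ i → Σℕ≡sum (2 ℕ.* v) (counted i)) ⟩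
      sum {2 ℕ.* v} (λ i → sum (λ j → + counted i j))
        ≡⟨ sum-cong-≗ {2 ℕ.* v} (λ i → sum-single (λ j → + counted i j) (partner i m) (others i)) ⟩
      sum {2 ℕ.* v} (λ i → + counted i (partner i m))
        ≡⟨ sum-cong-≗ {2 ℕ.* v} (λ i → cong (λ b → + boolToℕ (X i ∧ X (partner i m) ∧ b)) (diffIs-true v i _ m (partner-diff i m))) ⟩
      sum {2 ℕ.* v} (λ i → + boolToℕ (X i ∧ X (partner i m) ∧ true)) ∎
      where
      counted : Fin (2 ℕ.* v) → Fin (2 ℕ.* v) → ℕ
      counted i j = boolToℕ (X i ∧ X j ∧ diffIs v i j m)
      others : ∀ i j → j ≢ partner i m → + counted i j ≡ 0ℤ
      others i j j≢partner
        rewrite diffIs-false v i j m (λ diff → j≢partner (toℕ-injective (diff-unique (toℕ<n j) (toℕ<n (partner i m)) diff (partner-diff i m))))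
              | ∧-zeroʳ (X j) | ∧-zeroʳ (X i) = refl

    pairCount-corr : ∀ m → + 2 * + pairCount v X m ≡ + v + corr G (toℕ m)
    pairCount-corr m = ℤP.*-cancelˡ-≡ (+ 2) (+ 2 * + pairCount v X m) (+ v + corr G (toℕ m)) (begin
      + 2 * (+ 2 * + pairCount v X m)        ≡⟨ ℤP.*-assoc (+ 2) (+ 2) (+ pairCount v X m) ⟨
      + 4 * + pairCount v X m                ≡⟨ cong (+ 4 *_) (pairCount-partner m) ⟩
      + 4 * sum {2 ℕ.* v} (λ i → + boolToℕ (X i ∧ X (partner i m) ∧ true))
        ≡⟨ *-distribˡ-sum {2 ℕ.* v} (+ 4) (λ i → + boolToℕ (X i ∧ X (partner i m) ∧ true)) ⟩
      sum {2 ℕ.* v} (λ i → + 4 * + boolToℕ (X i ∧ X (partner i m) ∧ true))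
        ≡⟨ sum-cong-≗ {2 ℕ.* v} term ⟩
      ∑< (2 ℕ.* v) F                         ≡⟨ cong (λ n → ∑< n F) (cong (v ℕ.+_) (ℕP.+-identityʳ v)) ⟩
      ∑< (v ℕ.+ v) F                         ≡⟨ pairing G-neg (translate G-neg (k ℕ.* c)) ⟩
      + 2 * (+ v + corr G k)                 ∎)
      where
      k = toℕ m
      F : ℕ → ℤ
      F y = (1ℤ + G y) * (1ℤ + G (y ℕ.+ k ℕ.* c))
      term : ∀ i → + 4 * + boolToℕ (X i ∧ X (partner i m) ∧ true) ≡ F (toℕ i)
      term i = trans (indicator-∧ (X i) (X (partner i m)))
                     (cong₂ (λ p q → (1ℤ + p) * (1ℤ + q)) (X≗G i)
                            (trans (X≗G (partner i m)) (diff-translate G-neg (partner-diff i m))))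

  golay-low : ∀ {a b} → IsNegaperiodicGolayPair v a b → ∀ k → 0 ℕ.< k → k ℕ.< v →
              corr (ext a) k + corr (ext b) k ≡ 0ℤ
  golay-low {a} {b} golay k 0<k k<v =
    trans (sym (cong₂ _+_ (NAF≡corr a k) (NAF≡corr b k))) (golay k 0<k k<v)

  golay-cancel : ∀ {a b} → IsNegaperiodicGolayPair v a b → ∀ k → k ≢ 0 → k ≢ v → k ℕ.< v ℕ.+ v →
                 corr (ext a) k + corr (ext b) k ≡ 0ℤ
  golay-cancel {a} {b} golay k k≢0 k≢v k<2v with k ℕ.<? v
  ... | yes k<v = golay-low {a} {b} golay k (ℕP.n≢0⇒n>0 k≢0) k<v
  golay-cancel {a} {b} golay k k≢0 k≢v k<2v | no k≮v = begin
    corr (ext a) k + corr (ext b) k                  ≡⟨ cong (λ z → corr (ext a) z + corr (ext b) z) v+k′≡k ⟨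
    corr (ext a) (v ℕ.+ k′) + corr (ext b) (v ℕ.+ k′) ≡⟨ cong₂ _+_ (corr-shift {ext a} (ext-neg a) k′) (corr-shift {ext b} (ext-neg b) k′) ⟩
    - corr (ext a) k′ + - corr (ext b) k′            ≡⟨ ℤP.neg-distrib-+ (corr (ext a) k′) (corr (ext b) k′) ⟨
    - (corr (ext a) k′ + corr (ext b) k′)            ≡⟨ cong -_ (golay-low {a} {b} golay k′ 0<k′ k′<v) ⟩
    0ℤ                                               ∎
    where
    k′ = k ∸ v
    v+k′≡k : v ℕ.+ k′ ≡ k
    v+k′≡k = ℕP.m+[n∸m]≡n (ℕP.≮⇒≥ k≮v)
    0<k′ : 0 ℕ.< k′
    0<k′ = ℕP.n≢0⇒n>0 (λ k′≡0 → k≢v (trans (sym v+k′≡k) (trans (cong (v ℕ.+_) k′≡0) (ℕP.+-identityʳ v))))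
    k′<v : k′ ℕ.< v
    k′<v = ℕP.m<n+o⇒m∸n<o k v k<2v

counts-sum : ∀ {v P Q s t} → + 2 * + P ≡ + v + s → + 2 * + Q ≡ + v + t → s + t ≡ 0ℤ → P ℕ.+ Q ≡ v
counts-sum {v} {P} {Q} {s} {t} countP countQ s+t≡0 = ℤP.+-injective (ℤP.*-cancelˡ-≡ (+ 2) (+ (P ℕ.+ Q)) (+ v) (begin
  + 2 * + (P ℕ.+ Q)            ≡⟨ cong (+ 2 *_) (ℤP.pos-+ P Q) ⟩
  + 2 * (+ P + + Q)            ≡⟨ ℤP.*-distribˡ-+ (+ 2) (+ P) (+ Q) ⟩
  + 2 * + P + + 2 * + Q        ≡⟨ cong₂ _+_ countP countQ ⟩
  (+ v + s) + (+ v + t)        ≡⟨ regroup (+ v) s t ⟩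
  + 2 * + v + (s + t)          ≡⟨ cong (λ z → + 2 * + v + z) s+t≡0 ⟩
  + 2 * + v + 0ℤ               ≡⟨ ℤP.+-identityʳ _ ⟩
  + 2 * + v                    ∎))
  where
  regroup : ∀ n s t → (n + s) + (n + t) ≡ + 2 * n + (s + t)
  regroup = ℤ-Ring.solve-∀

count-zero : ∀ {v P s} → + 2 * + P ≡ + v + s → s ≡ - + v → P ≡ 0
count-zero {v} {P} {s} countP s≡-v = ℤP.+-injective (ℤP.*-cancelˡ-≡ (+ 2) (+ P) 0ℤ (begin
  + 2 * + P      ≡⟨ countP ⟩
  + v + s        ≡⟨ cong (λ z → + v + z) s≡-v ⟩
  + v + - + v    ≡⟨ ℤP.+-inverseʳ (+ v) ⟩
  0ℤ             ∎))

proposition5 : (v : ℕ) → 1 ≤ v → (a b : BinSeq v) →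
    IsNegaperiodicGolayPair v a b →
    IsRelDiffFamily v (Φ v a ∷ Φ v b ∷ []) v
proposition5 zero    ()
proposition5 (suc w) _  a b golay = nonzero-differences , difference-v
  where
  open Negaperiodic w

  count : ∀ x m → + 2 * + pairCount v (Φ v x) m ≡ + v + corr (ext x) (toℕ m)
  count x = PairCount.pairCount-corr (Φ v x) (ext-neg x) (Φ-ext x)

  nonzero-differences : ∀ m → toℕ m ≢ 0 → toℕ m ≢ v → tripleCount v (Φ v a ∷ Φ v b ∷ []) m ≡ v
  nonzero-differences m m≢0 m≢v = trans (cong (pairCount v (Φ v a) m ℕ.+_) (ℕP.+-identityʳ _))
    (counts-sum {v} {pairCount v (Φ v a) m} {pairCount v (Φ v b) m} {corr (ext a) (toℕ m)} {corr (ext b) (toℕ m)}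
                (count a m) (count b m) (golay-cancel {a} {b} golay (toℕ m) m≢0 m≢v (toℕ<v+v m)))

  difference-v : ∀ m → toℕ m ≡ v → tripleCount v (Φ v a ∷ Φ v b ∷ []) m ≡ 0
  difference-v m m≡v = cong₂ ℕ._+_ (no-pairs a) (cong (ℕ._+ 0) (no-pairs b))
    where
    corr-at-v : ∀ x → corr (ext x) (toℕ m) ≡ - + v
    corr-at-v x = trans (cong (corr (ext x)) m≡v) (corr-v {ext x} (ext-neg x) (ext-sq x))
    no-pairs : ∀ x → pairCount v (Φ v x) m ≡ 0
    no-pairs x = count-zero {v} {pairCount v (Φ v x) m} {corr (ext x) (toℕ m)}
                            (count x m) (corr-at-v x)
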